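{- If there is a valid assignment at time $t$, then the canonical assignment at time $t$ is valid.
   Context: Two schedules (SLF and OPT=SRPT) of the same jobs on a single machine; at time $t$, $\mathrm{SLF}(t)$ and $\mathrm{OPT}(t)$ are their sets of active jobs with remaining processing times $r_i(t)$ and $r^*_j(t)$. An assignment at time $t$ is $\sigma:\mathrm{SLF}(t)\times\mathrm{OPT}(t)\to\mathbb{R}_{\ge0}$ with $\sum_j\sigma(i,j)=r_i(t)$ and $\sum_i\sigma(i,j)=r^*_j(t)$. Order $\mathrm{OPT}(t)$ by non-increasing $r^*_j(t)$ and $\mathrm{SLF}(t)$ by non-increasing $r_i(t)$ (ties by identifiers). For $S\subseteq\mathrm{OPT}(t)$, $N_\sigma(S)=\{i:\exists j\in S,\sigma(i,j)>0\}$; the prefix expansion is $\max_{P^*}|N_\sigma(P^*)|/|P^*|$ over nonempty prefixes $P^*$ of $\mathrm{OPT}(t)$; $\sigma$ is valid if this is at most $\lceil1/\varepsilon\rceil$ (for a fixed $\varepsilon\in(0,1]$). The canonical assignment is obtained greedily: for each $j\in\mathrm{OPT}(t)$ in non-increasing order of $r^*_j(t)$, allocate value $r^*_j(t)$ using the minimum number of edges to the jobs of largest (not yet exhausted) remaining time in $\mathrm{SLF}(t)$, never exceeding any SLF job's total $r_i(t)$.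
   Formalization: The remaining times $r_i(t)$ and $r^*_j(t)$, the parameter ε and the values of the assignments σ are rational rather than real. -}

module Defs where

open import Data.Nat as ℕ using (ℕ; zero; suc)
open import Data.Fin using (Fin; toℕ)
open import Data.Fin.Properties using (any?)
open import Data.Integer as ℤ using (ℤ)
open import Data.Rational as ℚ using (ℚ; 0ℚ; 1ℚ; _+_; _-_; _⊓_; _≤_; _<_; >-nonZero; ceiling; 1/_)
open import Data.Rational.Properties as ℚP using ()
open import Data.Vec using (Vec; []; _∷_; lookup)
open import Data.Product using (_×_; _,_; ∃; Σ)
open import Data.Bool using (Bool; true; false)
open import Relation.Nullary using (does)

-- SLF(t) = Fin n, OPT(t) = Fin m.  Remaining times are
-- vectors r : Vec ℚ n and r* : Vec ℚ m.  Identifiers are the indices;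
-- the vectors are assumed listed in the paper's order (non-increasing
-- remaining time, ties by identifier = index), see `Sorted`.

∑ : ∀ {k} → (Fin k → ℚ) → ℚ
∑ {zero}  f = 0ℚ
∑ {suc k} f = f Data.Fin.zero + ∑ (λ i → f (Data.Fin.suc i))

count : ∀ {k} → (Fin k → Bool) → ℕ
count {zero}  p = 0
count {suc k} p with p Data.Fin.zero
... | true  = suc (count (λ i → p (Data.Fin.suc i)))
... | false = count (λ i → p (Data.Fin.suc i))

Sorted : ∀ {k} → Vec ℚ k → Set
Sorted {k} v = ∀ (a b : Fin k) → toℕ a ℕ.≤ toℕ b → lookup v b ≤ lookup v a

-- all entries positive (active jobs have positive remaining time)
AllPos : ∀ {k} → Vec ℚ k → Set
AllPos {k} v = ∀ (a : Fin k) → 0ℚ < lookup v a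

Assignment : ℕ → ℕ → Set
Assignment n m = Fin n → Fin m → ℚ

IsAssignment : ∀ {n m} → Vec ℚ n → Vec ℚ m → Assignment n m → Set
IsAssignment {n} {m} r r* σ =
  (∀ i j → 0ℚ ≤ σ i j) ×
  (∀ i → ∑ (λ j → σ i j) ≡ lookup r i) ×
  (∀ j → ∑ (λ i → σ i j) ≡ lookup r* j)
  where open import Relation.Binary.PropositionalEquality using (_≡_)

-- |N_σ(P*)| for the prefix P* = first p jobs of OPT(t)
-- (i ∈ N_σ(P*) iff ∃ j ∈ P*, σ(i,j) > 0)
prefixNbhd : ∀ {n m} → Assignment n m → ℕ → ℕ
prefixNbhd {n} {m} σ p =
  count (λ i → does (any? (λ j → (toℕ j ℕ.<? p) ×-dec (0ℚ ℚP.<? σ i j))))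
  where open import Relation.Nullary.Decidable using (_×-dec_)

ceilInv : (ε : ℚ) → 0ℚ < ε → ℤ
ceilInv ε ε>0 = ceiling ((1/ ε) {{>-nonZero ε>0}})

-- prefix expansion ≤ ⌈1/ε⌉ :  for every nonempty prefix P* (of size p,
-- 1 ≤ p ≤ m),  |N_σ(P*)| / |P*| ≤ ⌈1/ε⌉, i.e. |N_σ(P*)| ≤ ⌈1/ε⌉ · p.
Valid : ∀ {n m} (ε : ℚ) → 0ℚ < ε → Assignment n m → Set
Valid {n} {m} ε ε>0 σ =
  ∀ (p : ℕ) → 1 ℕ.≤ p → p ℕ.≤ m →
    ℤ.+ (prefixNbhd σ p) ℤ.≤ ceilInv ε ε>0 ℤ.* ℤ.+ p

-- Canonical (greedy) assignment.
-- `fillRow d caps` allocates demand d to the SLF jobs in order (largest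
-- remaining time first), taking from each not-yet-exhausted job as much
-- as possible (min of its residual capacity and the residual demand), so
-- that the minimum number of edges is used; returns the allocation row
-- and the new residual capacities.
fillRow : ∀ {n} → ℚ → Vec ℚ n → Vec ℚ n × Vec ℚ n
fillRow d [] = [] , []
fillRow d (c ∷ cs) with fillRow (d - (d ⊓ c)) cs
... | row , cs' = (d ⊓ c) ∷ row , (c - (d ⊓ c)) ∷ cs'

-- process OPT jobs in order (non-increasing r*), starting from residual
-- capacities caps; row j = allocation of OPT job j.
canonRows : ∀ {n m} → Vec ℚ n → Vec ℚ m → Vec (Vec ℚ n) m
canonRows caps [] = []
canonRows caps (b ∷ bs) with fillRow b caps
... | row , caps' = row ∷ canonRows caps' bs

canonical : ∀ {n m} → Vec ℚ n → Vec ℚ m → Assignment n m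
canonical r r* i j = lookup (lookup (canonRows r r*) j) i

{-# OPTIONS --safe #-}

-- For any assignment σ and any prefix P* of the first p jobs of OPT(t), the total
-- remaining time of P* is carried by N_σ(P*), so it is at most the total of the
-- |N_σ(P*)| largest jobs of SLF(t). The greedy rule serves the OPT jobs in order,
-- always from the largest SLF job that is not yet exhausted, so it serves all of P*
-- from those |N_σ(P*)| jobs. Hence every prefix neighbourhood of the canonical
-- assignment is at most as large as that of σ, and validity transfers.

module Submission where

open import Defs
open import Data.Nat as ℕ using (ℕ; zero; suc; z≤n; s≤s; _<?_)
import Data.Nat.Properties as ℕP
open import Data.Fin as F using (Fin; toℕ)
open import Data.Fin.Properties using (any?)
open import Data.Rational using (ℚ; 0ℚ; 1ℚ; _<_; _≤_; _+_; _-_; _⊓_; -_)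
import Data.Rational.Properties as ℚP
open import Data.Rational.Solver using (module +-*-Solver)
open import Algebra.Properties.Group ℚP.+-0-group using (∙-cancelʳ)
import Data.Integer as ℤ
import Data.Integer.Properties as ℤP
open import Data.Vec using (Vec; []; _∷_; lookup)
open import Data.Vec.Relation.Unary.All using (All; []; _∷_)
open import Data.Vec.Relation.Unary.All.Properties using (lookup⁺; lookup⁻)
open import Data.Product using (_×_; ∃; _,_; proj₁; proj₂)
open import Data.Empty using (⊥-elim)
open import Data.Bool using (Bool; true; false; if_then_else_)
open import Data.Sum using (inj₁; inj₂)
open import Relation.Binary.PropositionalEquality
open import Relation.Nullary using (yes; no; does)
open import Relation.Nullary.Reflects using (ofʸ)
open import Relation.Nullary.Decidable using (_×-dec_)

open +-*-Solver using (solve; _:+_; _:-_; :-_; _:=_)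

private
  variable
    k n m : ℕ

p≤p+q : ∀ {p q} → 0ℚ ≤ q → p ≤ p + q
p≤p+q {p} {q} 0≤q = subst (_≤ p + q) (ℚP.+-identityʳ p) (ℚP.+-monoʳ-≤ p 0≤q)

+-cancelʳ-≤ : ∀ {p q r} → p + r ≤ q + r → p ≤ q
+-cancelʳ-≤ {p} {q} {r} h = subst₂ _≤_ (undo p) (undo q) (ℚP.+-monoˡ-≤ (- r) h)
  where
  undo : ∀ x → x + r + - r ≡ x
  undo x = solve 2 (λ x r → x :+ r :+ (:- r) := x) refl x r

p≤q⇒0≤q-p : ∀ {p q} → p ≤ q → 0ℚ ≤ q - p
p≤q⇒0≤q-p {p} {q} p≤q = +-cancelʳ-≤ (subst₂ _≤_ (sym (ℚP.+-identityˡ p)) (sym (q-p+p q p)) p≤q)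
  where
  q-p+p : ∀ q p → q - p + p ≡ q
  q-p+p = solve 2 (λ q p → q :- p :+ p := q) refl

p≤q+r⇒p-q≤r : ∀ {p q r} → p ≤ q + r → p - q ≤ r
p≤q+r⇒p-q≤r {p} {q} {r} h = +-cancelʳ-≤ (subst₂ _≤_ (sym (p-q+q p q)) (ℚP.+-comm q r) h)
  where
  p-q+q : ∀ p q → p - q + q ≡ p
  p-q+q = solve 2 (λ p q → p :- q :+ q := p) refl

p-p⊓q≤r : ∀ {p q r} → 0ℚ ≤ r → p ≤ q + r → p - p ⊓ q ≤ r
p-p⊓q≤r {p} {q} {r} 0≤r h with ℚP.≤-total p q
... | inj₁ p≤q rewrite ℚP.p≤q⇒p⊓q≡p p≤q | ℚP.+-inverseʳ p = 0≤r
... | inj₂ q≤p rewrite ℚP.p≥q⇒p⊓q≡q q≤p = p≤q+r⇒p-q≤r h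

∑-cong : {f g : Fin k → ℚ} → (∀ i → f i ≡ g i) → ∑ f ≡ ∑ g
∑-cong {zero}  f≡g = refl
∑-cong {suc k} f≡g = cong₂ _+_ (f≡g F.zero) (∑-cong (λ i → f≡g (F.suc i)))

∑-mono-≤ : {f g : Fin k → ℚ} → (∀ i → f i ≤ g i) → ∑ f ≤ ∑ g
∑-mono-≤ {zero}  f≤g = ℚP.≤-refl
∑-mono-≤ {suc k} f≤g = ℚP.+-mono-≤ (f≤g F.zero) (∑-mono-≤ (λ i → f≤g (F.suc i)))

∑-zero : ∀ k → ∑ {k} (λ _ → 0ℚ) ≡ 0ℚ
∑-zero zero    = refl
∑-zero (suc k) = cong (0ℚ +_) (∑-zero k)

∑-distrib-+ : (f g : Fin k → ℚ) → ∑ (λ i → f i + g i) ≡ ∑ f + ∑ g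
∑-distrib-+ {zero}  f g = refl
∑-distrib-+ {suc k} f g = begin
  (f₀ + g₀) + ∑ (λ i → f′ i + g′ i) ≡⟨ cong ((f₀ + g₀) +_) (∑-distrib-+ f′ g′) ⟩
  (f₀ + g₀) + (∑ f′ + ∑ g′)         ≡⟨ interchange f₀ g₀ (∑ f′) (∑ g′) ⟩
  (f₀ + ∑ f′) + (g₀ + ∑ g′)         ∎
  where
  open ≡-Reasoning
  f₀ g₀ : ℚ
  f₀ = f F.zero
  g₀ = g F.zero
  f′ g′ : Fin k → ℚ
  f′ i = f (F.suc i)
  g′ i = g (F.suc i)
  interchange : ∀ a b c d → (a + b) + (c + d) ≡ (a + c) + (b + d)
  interchange = solve 4 (λ a b c d → (a :+ b) :+ (c :+ d) := (a :+ c) :+ (b :+ d)) refl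

∑-comm : (f : Fin n → Fin m → ℚ) → ∑ (λ i → ∑ (λ j → f i j)) ≡ ∑ (λ j → ∑ (λ i → f i j))
∑-comm {zero}  {m} f = sym (∑-zero m)
∑-comm {suc n} f = trans (cong (∑ (f F.zero) +_) (∑-comm (λ i → f (F.suc i))))
                         (sym (∑-distrib-+ (f F.zero) _))

mask : Bool → ℚ → ℚ
mask b x = if b then x else 0ℚ

mask-∑ : ∀ b (f : Fin k → ℚ) → mask b (∑ f) ≡ ∑ (λ i → mask b (f i))
mask-∑ true  f = refl
mask-∑ {k} false f = sym (∑-zero k)

mask≤ : ∀ b {x} → 0ℚ ≤ x → mask b x ≤ x
mask≤ true  0≤x = ℚP.≤-refl
mask≤ false 0≤x = 0≤x

count≤ : ∀ (b : Fin k → Bool) s → (∀ i → b i ≡ true → toℕ i ℕ.< s) → count b ℕ.≤ s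
count≤ {zero}  b s below = z≤n
count≤ {suc k} b s below with b F.zero in b₀
count≤ {suc k} b zero    below | true with () ← below F.zero b₀
count≤ {suc k} b (suc s) below | true =
  s≤s (count≤ (λ i → b (F.suc i)) s (λ i bi → ℕP.≤-pred (below (F.suc i) bi)))
... | false = count≤ (λ i → b (F.suc i)) s (λ i bi → ℕP.<⇒≤ (below (F.suc i) bi))

NonNeg : Vec ℚ n → Set
NonNeg = All (0ℚ ≤_)

Sorted-tail : ∀ x (xs : Vec ℚ n) → Sorted (x ∷ xs) → Sorted xs
Sorted-tail x xs sorted a b a≤b = sorted (F.suc a) (F.suc b) (s≤s a≤b)

sumFirst : ℕ → Vec ℚ n → ℚ
sumFirst _       []       = 0ℚ
sumFirst zero    (x ∷ xs) = 0ℚ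
sumFirst (suc s) (x ∷ xs) = x + sumFirst s xs

sumFirst-zero : (v : Vec ℚ n) → sumFirst 0 v ≡ 0ℚ
sumFirst-zero []      = refl
sumFirst-zero (_ ∷ _) = refl

∑-lookup : (v : Vec ℚ n) → ∑ (lookup v) ≡ sumFirst n v
∑-lookup []       = refl
∑-lookup (x ∷ xs) = cong (x +_) (∑-lookup xs)

sumFirst-nonneg : {v : Vec ℚ n} → NonNeg v → ∀ s → 0ℚ ≤ sumFirst s v
sumFirst-nonneg []           s       = ℚP.≤-refl
sumFirst-nonneg (0≤x ∷ 0≤xs) zero    = ℚP.≤-refl
sumFirst-nonneg (0≤x ∷ 0≤xs) (suc s) = ℚP.+-mono-≤ 0≤x (sumFirst-nonneg 0≤xs s)

sumFirst-masked : (v : Vec ℚ n) → ∀ p → sumFirst p v ≡ ∑ (λ j → mask (toℕ j ℕ.<ᵇ p) (lookup v j))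
sumFirst-masked []                p       = refl
sumFirst-masked {suc n} (x ∷ xs)  zero    = sym (cong (0ℚ +_) (∑-zero n))
sumFirst-masked (x ∷ xs)          (suc p) = cong (x +_) (sumFirst-masked xs p)

sumFirst-tail≤ : ∀ x (xs : Vec ℚ n) → Sorted (x ∷ xs) → NonNeg (x ∷ xs) →
                 ∀ s → sumFirst s xs ≤ sumFirst s (x ∷ xs)
sumFirst-tail≤ x xs       sorted nn        zero    = ℚP.≤-reflexive (sumFirst-zero xs)
sumFirst-tail≤ x []       sorted (0≤x ∷ _) (suc s) = ℚP.+-mono-≤ 0≤x ℚP.≤-refl
sumFirst-tail≤ x (y ∷ ys) sorted (_ ∷ nn)  (suc s) =
  ℚP.+-mono-≤ (sorted F.zero (F.suc F.zero) z≤n) (sumFirst-tail≤ y ys (Sorted-tail x (y ∷ ys) sorted) nn s)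

masked-∑≤sumFirst : (v : Vec ℚ n) → Sorted v → NonNeg v → (b : Fin n → Bool) →
                    ∀ s → count b ℕ.≤ s → ∑ (λ i → mask (b i) (lookup v i)) ≤ sumFirst s v
masked-∑≤sumFirst []       _      _  _ _ _       = ℚP.≤-refl
masked-∑≤sumFirst (x ∷ xs) sorted nn b s count≤s with b F.zero
masked-∑≤sumFirst (x ∷ xs) sorted (_ ∷ nn) b (suc s) (s≤s count≤s) | true =
  ℚP.+-monoʳ-≤ x (masked-∑≤sumFirst xs (Sorted-tail x xs sorted) nn (λ i → b (F.suc i)) s count≤s)
masked-∑≤sumFirst (x ∷ xs) sorted (0≤x ∷ nn) b s count≤s | false = begin
  0ℚ + ∑ (λ i → mask (b′ i) (lookup xs i)) ≡⟨ ℚP.+-identityˡ _ ⟩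
  ∑ (λ i → mask (b′ i) (lookup xs i))      ≤⟨ masked-∑≤sumFirst xs (Sorted-tail x xs sorted) nn b′ s count≤s ⟩
  sumFirst s xs                            ≤⟨ sumFirst-tail≤ x xs sorted (0≤x ∷ nn) s ⟩
  sumFirst s (x ∷ xs)                      ∎
  where
  open ℚP.≤-Reasoning
  b′ : Fin _ → Bool
  b′ i = b (F.suc i)

-- prefixNbhd σ p is definitionally count (inNbhd σ p).
inNbhd : Assignment n m → ℕ → Fin n → Bool
inNbhd σ p i = does (any? (λ j → (toℕ j <? p) ×-dec (0ℚ ℚP.<? σ i j)))

inNbhd-witness : (σ : Assignment n m) → ∀ p i → inNbhd σ p i ≡ true →
                 ∃ λ j → toℕ j ℕ.< p × 0ℚ < σ i j
inNbhd-witness σ p i inN with any? (λ j → (toℕ j <? p) ×-dec (0ℚ ℚP.<? σ i j))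
inNbhd-witness σ p i inN  | yes witness = witness
inNbhd-witness σ p i ()   | no _

prefixRow≤nbhdRow : (σ : Assignment n m) → (∀ i j → 0ℚ ≤ σ i j) → ∀ p i →
  ∑ (λ j → mask (toℕ j ℕ.<ᵇ p) (σ i j)) ≤ mask (inNbhd σ p i) (∑ (σ i))
prefixRow≤nbhdRow {m = m} σ σ≥0 p i with any? (λ j → (toℕ j <? p) ×-dec (0ℚ ℚP.<? σ i j))
... | yes _    = ∑-mono-≤ (λ j → mask≤ (toℕ j ℕ.<ᵇ p) (σ≥0 i j))
... | no ¬edge = ℚP.≤-trans (∑-mono-≤ masked≤0) (ℚP.≤-reflexive (∑-zero m))
  where
  masked≤0 : ∀ j → mask (toℕ j ℕ.<ᵇ p) (σ i j) ≤ 0ℚ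
  masked≤0 j with toℕ j ℕ.<ᵇ p | ℕP.<ᵇ-reflects-< (toℕ j) p
  ... | true  | ofʸ j<p = ℚP.≮⇒≥ (λ σij>0 → ¬edge (j , j<p , σij>0))
  ... | false | _       = ℚP.≤-refl

prefixDemand≤nbhdCapacity : (r : Vec ℚ n) (r* : Vec ℚ m) (σ : Assignment n m) →
  Sorted r → NonNeg r → IsAssignment r r* σ → ∀ p → sumFirst p r* ≤ sumFirst (prefixNbhd σ p) r
prefixDemand≤nbhdCapacity r r* σ sorted r≥0 (σ≥0 , rowSum , colSum) p = begin
  sumFirst p r*                                ≡⟨ sumFirst-masked r* p ⟩
  ∑ (λ j → inP j (lookup r* j))                ≡⟨ ∑-cong (λ j → cong (inP j) (sym (colSum j))) ⟩
  ∑ (λ j → inP j (∑ (λ i → σ i j)))            ≡⟨ ∑-cong (λ j → mask-∑ _ (λ i → σ i j)) ⟩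
  ∑ (λ j → ∑ (λ i → inP j (σ i j)))            ≡⟨ ∑-comm (λ i j → inP j (σ i j)) ⟨
  ∑ (λ i → ∑ (λ j → inP j (σ i j)))            ≤⟨ ∑-mono-≤ (prefixRow≤nbhdRow σ σ≥0 p) ⟩
  ∑ (λ i → mask (inNbhd σ p i) (∑ (σ i)))      ≡⟨ ∑-cong (λ i → cong (mask (inNbhd σ p i)) (rowSum i)) ⟩
  ∑ (λ i → mask (inNbhd σ p i) (lookup r i))   ≤⟨ masked-∑≤sumFirst r sorted r≥0 (inNbhd σ p) _ ℕP.≤-refl ⟩
  sumFirst (prefixNbhd σ p) r                  ∎
  where
  open ℚP.≤-Reasoning
  inP : Fin _ → ℚ → ℚ
  inP j = mask (toℕ j ℕ.<ᵇ p)

assignment-total : (r : Vec ℚ n) (r* : Vec ℚ m) (σ : Assignment n m) →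
                   IsAssignment r r* σ → sumFirst m r* ≡ sumFirst n r
assignment-total r r* σ (_ , rowSum , colSum) = begin
  sumFirst _ r*               ≡⟨ ∑-lookup r* ⟨
  ∑ (lookup r*)               ≡⟨ ∑-cong colSum ⟨
  ∑ (λ j → ∑ (λ i → σ i j))   ≡⟨ ∑-comm σ ⟨
  ∑ (λ i → ∑ (σ i))           ≡⟨ ∑-cong rowSum ⟩
  ∑ (lookup r)                ≡⟨ ∑-lookup r ⟩
  sumFirst _ r                ∎
  where open ≡-Reasoning

allocation : ℚ → Vec ℚ n → Vec ℚ n
allocation d cs = proj₁ (fillRow d cs)

residual : ℚ → Vec ℚ n → Vec ℚ n
residual d cs = proj₂ (fillRow d cs)

allocation-nonneg : ∀ {d} {cs : Vec ℚ n} → 0ℚ ≤ d → NonNeg cs → NonNeg (allocation d cs)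
allocation-nonneg             0≤d []           = []
allocation-nonneg {d = d} {c ∷ cs} 0≤d (0≤c ∷ 0≤cs) =
  ℚP.⊓-glb 0≤d 0≤c ∷ allocation-nonneg (p≤q⇒0≤q-p (ℚP.p⊓q≤p d c)) 0≤cs

residual-nonneg : ∀ d {cs : Vec ℚ n} → NonNeg cs → NonNeg (residual d cs)
residual-nonneg d          []         = []
residual-nonneg d {c ∷ cs} (_ ∷ 0≤cs) = p≤q⇒0≤q-p (ℚP.p⊓q≤q d c) ∷ residual-nonneg (d - d ⊓ c) 0≤cs

residual+allocation : ∀ d (cs : Vec ℚ n) i →
                      lookup (residual d cs) i + lookup (allocation d cs) i ≡ lookup cs i
residual+allocation d (c ∷ cs) F.zero    = solve 2 (λ a c → c :- a :+ a := c) refl (d ⊓ c) c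
residual+allocation d (c ∷ cs) (F.suc i) = residual+allocation (d - d ⊓ c) cs i

allocation-of-zero : {cs : Vec ℚ n} → NonNeg cs → ∀ i → lookup (allocation 0ℚ cs) i ≡ 0ℚ
allocation-of-zero {cs = c ∷ cs} (0≤c ∷ 0≤cs) i rewrite ℚP.p≤q⇒p⊓q≡p 0≤c with i
... | F.zero  = refl
... | F.suc i = allocation-of-zero 0≤cs i

allocation-beyond : ∀ {d} {cs : Vec ℚ n} → 0ℚ ≤ d → NonNeg cs → ∀ s → d ≤ sumFirst s cs →
                    ∀ i → s ℕ.≤ toℕ i → lookup (allocation d cs) i ≡ 0ℚ
allocation-beyond {d = d} {c ∷ cs} 0≤d nn zero d≤0 i _
  rewrite ℚP.≤-antisym d≤0 0≤d = allocation-of-zero nn i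
allocation-beyond {d = d} {c ∷ cs} 0≤d (_ ∷ 0≤cs) (suc s) d≤ (F.suc i) (s≤s s≤i) =
  allocation-beyond (p≤q⇒0≤q-p (ℚP.p⊓q≤p d c)) 0≤cs s (p-p⊓q≤r (sumFirst-nonneg 0≤cs s) d≤) i s≤i

sumFirst-allocation : ∀ {d} {cs : Vec ℚ n} → 0ℚ ≤ d → NonNeg cs → ∀ s → d ≤ sumFirst s cs →
                      sumFirst s (allocation d cs) ≡ d
sumFirst-allocation {cs = []}    0≤d _ s    d≤0 = ℚP.≤-antisym 0≤d d≤0
sumFirst-allocation {cs = _ ∷ _} 0≤d _ zero d≤0 = ℚP.≤-antisym 0≤d d≤0
sumFirst-allocation {d = d} {c ∷ cs} 0≤d (_ ∷ 0≤cs) (suc s) d≤ = begin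
  d ⊓ c + sumFirst s (allocation (d - d ⊓ c) cs) ≡⟨ cong (d ⊓ c +_) (sumFirst-allocation
                                                      (p≤q⇒0≤q-p (ℚP.p⊓q≤p d c)) 0≤cs s
                                                      (p-p⊓q≤r (sumFirst-nonneg 0≤cs s) d≤)) ⟩
  d ⊓ c + (d - d ⊓ c)                            ≡⟨ solve 2 (λ a d → a :+ (d :- a) := d) refl (d ⊓ c) d ⟩
  d                                              ∎
  where open ≡-Reasoning

sumFirst-residual+allocation : ∀ d (cs : Vec ℚ n) s →
  sumFirst s (residual d cs) + sumFirst s (allocation d cs) ≡ sumFirst s cs
sumFirst-residual+allocation d []       s       = refl
sumFirst-residual+allocation d (c ∷ cs) zero    = refl
sumFirst-residual+allocation d (c ∷ cs) (suc s) = begin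
  (c - a + R) + (a + A) ≡⟨ solve 4 (λ c a R A → (c :- a :+ R) :+ (a :+ A) := c :+ (R :+ A)) refl c a R A ⟩
  c + (R + A)           ≡⟨ cong (c +_) (sumFirst-residual+allocation (d - a) cs s) ⟩
  c + sumFirst s cs     ∎
  where
  open ≡-Reasoning
  a R A : ℚ
  a = d ⊓ c
  R = sumFirst s (residual (d - a) cs)
  A = sumFirst s (allocation (d - a) cs)

sumFirst-residual : ∀ {d} {cs : Vec ℚ n} → 0ℚ ≤ d → NonNeg cs → ∀ s → d ≤ sumFirst s cs →
                    sumFirst s (residual d cs) + d ≡ sumFirst s cs
sumFirst-residual {d = d} {cs} 0≤d nn s d≤ =
  trans (cong (sumFirst s (residual d cs) +_) (sym (sumFirst-allocation 0≤d nn s d≤)))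
        (sumFirst-residual+allocation d cs s)

canonRows-nonneg : {caps : Vec ℚ n} {bs : Vec ℚ m} → NonNeg caps → NonNeg bs →
                   ∀ j → NonNeg (lookup (canonRows caps bs) j)
canonRows-nonneg nc (0≤b ∷ _)   F.zero    = allocation-nonneg 0≤b nc
canonRows-nonneg {bs = b ∷ _} nc (_ ∷ 0≤bs) (F.suc j) =
  canonRows-nonneg (residual-nonneg b nc) 0≤bs j

canonRows-beyond : {caps : Vec ℚ n} {bs : Vec ℚ m} → NonNeg caps → NonNeg bs →
  ∀ s p → sumFirst p bs ≤ sumFirst s caps →
  ∀ j → toℕ j ℕ.< p → ∀ i → s ℕ.≤ toℕ i → lookup (lookup (canonRows caps bs) j) i ≡ 0ℚ
canonRows-beyond {caps = caps} {b ∷ bs} nc (0≤b ∷ 0≤bs) s (suc p) fits =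
  onRow
  where
  b≤ : b ≤ sumFirst s caps
  b≤ = ℚP.≤-trans (p≤p+q (sumFirst-nonneg 0≤bs p)) fits
  rest-fits : sumFirst p bs ≤ sumFirst s (residual b caps)
  rest-fits = +-cancelʳ-≤ (subst₂ _≤_ (ℚP.+-comm b (sumFirst p bs))
                                      (sym (sumFirst-residual 0≤b nc s b≤)) fits)
  onRow : ∀ j → toℕ j ℕ.< suc p → ∀ i → s ℕ.≤ toℕ i →
          lookup (lookup (canonRows caps (b ∷ bs)) j) i ≡ 0ℚ
  onRow F.zero    _         = allocation-beyond 0≤b nc s b≤
  onRow (F.suc j) (s≤s j<p) = canonRows-beyond (residual-nonneg b nc) 0≤bs s p rest-fits j j<p

residual-total : ∀ {b} {caps : Vec ℚ n} {bs : Vec ℚ m} → 0ℚ ≤ b → NonNeg caps → NonNeg bs →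
  b + sumFirst m bs ≡ sumFirst n caps → b ≤ sumFirst n caps × sumFirst m bs ≡ sumFirst n (residual b caps)
residual-total {n} {m} {b} {caps} {bs} 0≤b nc nbs total = b≤ , ∙-cancelʳ b _ _ (begin
  sumFirst m bs + b                ≡⟨ ℚP.+-comm (sumFirst m bs) b ⟩
  b + sumFirst m bs                ≡⟨ total ⟩
  sumFirst n caps                  ≡⟨ sumFirst-residual 0≤b nc n b≤ ⟨
  sumFirst n (residual b caps) + b ∎)
  where
  open ≡-Reasoning
  b≤ : b ≤ sumFirst n caps
  b≤ = subst (b ≤_) total (p≤p+q (sumFirst-nonneg nbs m))

lookup≤sumFirst : {v : Vec ℚ n} → NonNeg v → ∀ i → lookup v i ≤ sumFirst n v
lookup≤sumFirst {v = x ∷ xs} (_ ∷ 0≤xs) F.zero = p≤p+q (sumFirst-nonneg 0≤xs _)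
lookup≤sumFirst {v = x ∷ xs} (0≤x ∷ 0≤xs) (F.suc i) =
  ℚP.≤-trans (lookup≤sumFirst 0≤xs i) (subst (_ ≤_) (ℚP.+-comm _ x) (p≤p+q 0≤x))

canonRows-columnSum : {caps : Vec ℚ n} {bs : Vec ℚ m} → NonNeg caps → NonNeg bs →
  sumFirst m bs ≡ sumFirst n caps → ∀ j → sumFirst n (lookup (canonRows caps bs) j) ≡ lookup bs j
canonRows-columnSum nc (0≤b ∷ 0≤bs) total F.zero =
  sumFirst-allocation 0≤b nc _ (proj₁ (residual-total 0≤b nc 0≤bs total))
canonRows-columnSum {bs = b ∷ _} nc (0≤b ∷ 0≤bs) total (F.suc j) =
  canonRows-columnSum (residual-nonneg b nc) 0≤bs (proj₂ (residual-total 0≤b nc 0≤bs total)) j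

canonRows-rowSum : {caps : Vec ℚ n} {bs : Vec ℚ m} → NonNeg caps → NonNeg bs →
  sumFirst m bs ≡ sumFirst n caps → ∀ i → ∑ (λ j → lookup (lookup (canonRows caps bs) j) i) ≡ lookup caps i
canonRows-rowSum {bs = []} nc [] total i =
  ℚP.≤-antisym (lookup⁺ nc i) (ℚP.≤-trans (lookup≤sumFirst nc i) (ℚP.≤-reflexive (sym total)))
canonRows-rowSum {caps = caps} {b ∷ bs} nc (0≤b ∷ 0≤bs) total i = begin
  lookup (allocation b caps) i + ∑ (λ j → lookup (lookup (canonRows (residual b caps) bs) j) i)
    ≡⟨ cong (lookup (allocation b caps) i +_) (canonRows-rowSum (residual-nonneg b nc) 0≤bs
                                                 (proj₂ (residual-total 0≤b nc 0≤bs total)) i) ⟩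
  lookup (allocation b caps) i + lookup (residual b caps) i
    ≡⟨ ℚP.+-comm (lookup (allocation b caps) i) _ ⟩
  lookup (residual b caps) i + lookup (allocation b caps) i
    ≡⟨ residual+allocation b caps i ⟩
  lookup caps i
    ∎
  where open ≡-Reasoning

canonical-isAssignment : (r : Vec ℚ n) (r* : Vec ℚ m) → NonNeg r → NonNeg r* →
  sumFirst m r* ≡ sumFirst n r → IsAssignment r r* (canonical r r*)
canonical-isAssignment r r* r≥0 r*≥0 total =
  (λ i j → lookup⁺ (canonRows-nonneg r≥0 r*≥0 j) i) ,
  canonRows-rowSum r≥0 r*≥0 total ,
  (λ j → trans (∑-lookup (lookup (canonRows r r*) j)) (canonRows-columnSum r≥0 r*≥0 total j))

prefixNbhd-canonical≤ : {r : Vec ℚ n} {r* : Vec ℚ m} → NonNeg r → NonNeg r* →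
  ∀ s p → sumFirst p r* ≤ sumFirst s r → prefixNbhd (canonical r r*) p ℕ.≤ s
prefixNbhd-canonical≤ {r = r} {r*} r≥0 r*≥0 s p fits = count≤ (inNbhd (canonical r r*) p) s below
  where
  below : ∀ i → inNbhd (canonical r r*) p i ≡ true → toℕ i ℕ.< s
  below i inN with toℕ i <? s
  ... | yes i<s = i<s
  ... | no i≮s with inNbhd-witness (canonical r r*) p i inN
  ... | j , j<p , edge = ⊥-elim (ℚP.<-irrefl (sym vanishes) edge)
    where
    vanishes : canonical r r* i j ≡ 0ℚ
    vanishes = canonRows-beyond r≥0 r*≥0 s p fits j j<p i (ℕP.≮⇒≥ i≮s)

Valid-antimono : ∀ ε ε>0 (σ τ : Assignment n m) → (∀ p → prefixNbhd τ p ℕ.≤ prefixNbhd σ p) →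
                 Valid ε ε>0 σ → Valid ε ε>0 τ
Valid-antimono ε ε>0 σ τ τ≤σ σ-valid p 1≤p p≤m = ℤP.≤-trans (ℤ.+≤+ (τ≤σ p)) (σ-valid p 1≤p p≤m)

lemma5p5 : (ε : ℚ) (ε>0 : 0ℚ < ε) → ε ≤ 1ℚ →
    (n m : ℕ) (r : Vec ℚ n) (r* : Vec ℚ m) →
    Sorted r → Sorted r* → AllPos r → AllPos r* →
    ∃ (λ (σ : Assignment n m) → IsAssignment r r* σ × Valid ε ε>0 σ) →
    IsAssignment r r* (canonical r r*) × Valid ε ε>0 (canonical r r*)
lemma5p5 ε ε>0 _ n m r r* r-sorted _ r>0 r*>0 (σ , σ-assignment , σ-valid) =
  canonical-isAssignment r r* r≥0 r*≥0 (assignment-total r r* σ σ-assignment) ,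
  Valid-antimono ε ε>0 σ (canonical r r*) canonical≤σ σ-valid
  where
  r≥0 : NonNeg r
  r≥0 = lookup⁻ (λ i → ℚP.<⇒≤ (r>0 i))
  r*≥0 : NonNeg r*
  r*≥0 = lookup⁻ (λ j → ℚP.<⇒≤ (r*>0 j))
  canonical≤σ : ∀ p → prefixNbhd (canonical r r*) p ℕ.≤ prefixNbhd σ p
  canonical≤σ p = prefixNbhd-canonical≤ r≥0 r*≥0 (prefixNbhd σ p) p
                    (prefixDemand≤nbhdCapacity r r* σ r-sorted r≥0 σ-assignment p)
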